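{- Let $G$ be a graph and $a\in V(G)$. If $a$ is active in $G$, then every vertex $x$ of $G$ with $\deg_G(x)=\deg_G(a)$ is active in $G$; and if $a$ is inactive in $G$, then every vertex $x$ of $G$ with $\deg_G(x)=\deg_G(a)$ is inactive in $G$.
   Context: All graphs are finite and simple. A vertex $v$ of $G$ is active in $G$ if there is a set $W$ of four vertices containing $v$ such that the induced subgraph $\langle W\rangle_G$ is isomorphic to $P_4$, $C_4$ or $2K_2$ (equivalently, $v$ is one of the four vertices $a,b,c,d$ of some 2-switch acting on $G$, i.e. with $ab,cd\in E(G)$, $ac,bd\notin E(G)$); otherwise $v$ is inactive. -}

module Defs where

open import Data.Nat using (ℕ)
open import Data.Fin using (Fin)
open import Data.Bool using (Bool; true; false)
open import Data.List using (List; length; filter)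
open import Data.List using (allFin)
open import Data.Bool.Properties using (_≟_)
open import Data.Product using (Σ; ∃; _×_; _,_)
open import Data.Sum using (_⊎_)
open import Relation.Nullary using (¬_)
open import Relation.Binary.PropositionalEquality using (_≡_; _≢_)

record Graph (n : ℕ) : Set where
  field
    adj   : Fin n → Fin n → Bool
    sym   : ∀ u v → adj u v ≡ adj v u
    irrefl : ∀ v → adj v v ≡ false
open Graph public

Edge : ∀ {n} → Graph n → Fin n → Fin n → Set
Edge G u v = adj G u v ≡ true

deg : ∀ {n} → Graph n → Fin n → ℕ
deg {n} G v = length (filter (λ u → adj G v u ≟ true) (allFin n))

TwoSwitch : ∀ {n} → Graph n → Fin n → Fin n → Fin n → Fin n → Set
TwoSwitch G a b c d =
  (a ≢ b) × (a ≢ c) × (a ≢ d) × (b ≢ c) × (b ≢ d) × (c ≢ d) ×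
  Edge G a b × Edge G c d × ¬ Edge G a c × ¬ Edge G b d

Active : ∀ {n} → Graph n → Fin n → Set
Active {n} G v = Σ (Fin n) λ a → Σ (Fin n) λ b → Σ (Fin n) λ c → Σ (Fin n) λ d →
  TwoSwitch G a b c d × (v ≡ a ⊎ v ≡ b ⊎ v ≡ c ⊎ v ≡ d)

Inactive : ∀ {n} → Graph n → Fin n → Set
Inactive G v = ¬ Active G v

-- If x is inactive and a ≠ x, no vertex w ∈ N(x) ∖ N[a] can coexist with a vertex
-- z ∈ N(a) ∖ N[x], since (w, x, a, z) would be a 2-switch.  Hence the neighbourhoods of
-- x and a (each ignoring the other vertex) are nested, and when deg x = deg a they
-- coincide: x and a are twins.  Swapping two twins is an automorphism of G, and
-- automorphisms preserve activity, so an active a of the same degree would make x active.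
module Submission where

open import Defs renaming (sym to adj-sym)
open import Data.Nat using (ℕ; zero; suc; _≤_; _<_; z≤n; s≤s)
open import Data.Nat.Properties using (module ≤-Reasoning; +-mono-≤; +-mono-≤-<; +-mono-<-≤; <-irrefl; +-0-commutativeMonoid)
open import Data.Fin using (Fin) renaming (zero to fzero; suc to fsuc)
open import Data.Fin.Properties using (any?) renaming (_≟_ to _≟ᶠ_)
open import Data.Fin.Permutation using (Permutation; transpose; _⟨$⟩ʳ_)
open import Data.Bool using (Bool; true; false; if_then_else_)
open import Data.Bool.Properties using (_≟_; not-¬)
open import Data.List using (length; filter; tabulate)
open import Data.Product using (_×_; _,_)
open import Data.Sum using (_⊎_; inj₁; inj₂)
open import Data.Empty using (⊥; ⊥-elim)
open import Function using (_∘_; id; Injective; Injection)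
open import Function.Properties.Inverse using (↔⇒↣)
open import Relation.Nullary using (¬_; Dec; yes; no)
open import Relation.Nullary.Decidable using (dec-true; dec-false)
open import Relation.Nullary.Decidable.Core using (_×-dec_; _⊎-dec_; ¬?; decidable-stable)
open import Relation.Binary.PropositionalEquality using (_≡_; _≢_; refl; sym; trans; cong; subst)
open import Algebra.Properties.CommutativeMonoid.Sum +-0-commutativeMonoid using (sum; sum-permute)

private
  variable
    n : ℕ

count : (Fin n → Bool) → ℕ
count f = sum (λ i → if f i then 1 else 0)

count-tabulate : ∀ {A : Set} (f : A → Bool) {m} (g : Fin m → A) →
  length (filter (λ x → f x ≟ true) (tabulate g)) ≡ count (f ∘ g)
count-tabulate f {zero} g = refl
count-tabulate f {suc m} g with f (g fzero)
... | true  = cong suc (count-tabulate f (g ∘ fsuc))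
... | false = count-tabulate f (g ∘ fsuc)

deg≡count : (G : Graph n) (v : Fin n) → deg G v ≡ count (adj G v)
deg≡count G v = count-tabulate (adj G v) id

sum-mono-≤ : {f g : Fin n → ℕ} → (∀ i → f i ≤ g i) → sum f ≤ sum g
sum-mono-≤ {zero}  f≤g = z≤n
sum-mono-≤ {suc n} f≤g = +-mono-≤ (f≤g fzero) (sum-mono-≤ (f≤g ∘ fsuc))

sum-mono-< : {f g : Fin n → ℕ} → (∀ i → f i ≤ g i) → ∀ j → f j < g j → sum f < sum g
sum-mono-< f≤g fzero    fj<gj = +-mono-<-≤ fj<gj (sum-mono-≤ (f≤g ∘ fsuc))
sum-mono-< f≤g (fsuc j) fj<gj = +-mono-≤-< (f≤g fzero) (sum-mono-< (f≤g ∘ fsuc) j fj<gj)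

count-mono-< : {f g : Fin n → Bool} → (∀ i → f i ≡ true → g i ≡ true) →
  ∀ j → ¬ f j ≡ true → g j ≡ true → count f < count g
count-mono-< {f = f} {g} f⊆g j ¬fj gj = sum-mono-< indicator-≤ j indicator-<
  where
  indicator-≤ : ∀ i → (if f i then 1 else 0) ≤ (if g i then 1 else 0)
  indicator-≤ i with f i | g i | f⊆g i
  ... | false | _     | _   = z≤n
  ... | true  | true  | _   = s≤s z≤n
  ... | true  | false | f⊆g with () ← f⊆g refl
  indicator-< : (if f j then 1 else 0) < (if g j then 1 else 0)
  indicator-< rewrite gj with f j
  ... | false = s≤s z≤n
  ... | true  = ⊥-elim (¬fj refl)

count-permute : ∀ (f : Fin n → Bool) (π : Permutation n n) → count f ≡ count (f ∘ (π ⟨$⟩ʳ_))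
count-permute f = sum-permute (λ k → if f k then 1 else 0)

module _ (i j : Fin n) where

  transpose-matchˡ : transpose i j ⟨$⟩ʳ i ≡ j
  transpose-matchˡ rewrite dec-true (i ≟ᶠ i) refl = refl

  transpose-matchʳ : transpose i j ⟨$⟩ʳ j ≡ i
  transpose-matchʳ with j ≟ᶠ i
  ... | yes j≡i = j≡i
  ... | no  _   rewrite dec-true (j ≟ᶠ j) refl = refl

  transpose-other : ∀ {k} → k ≢ i → k ≢ j → transpose i j ⟨$⟩ʳ k ≡ k
  transpose-other {k} k≢i k≢j rewrite dec-false (k ≟ᶠ i) k≢i | dec-false (k ≟ᶠ j) k≢j = refl

  ≟-pair : ∀ k → k ≡ i ⊎ k ≡ j ⊎ (k ≢ i × k ≢ j)
  ≟-pair k with k ≟ᶠ i | k ≟ᶠ j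
  ... | yes k≡i | _       = inj₁ k≡i
  ... | no  _   | yes k≡j = inj₂ (inj₁ k≡j)
  ... | no  k≢i | no  k≢j = inj₂ (inj₂ (k≢i , k≢j))

module _ {m} {G : Graph m} {H : Graph n} {f : Fin m → Fin n}
         (f-injective : Injective _≡_ _≡_ f)
         (f-induced : ∀ u v → adj H (f u) (f v) ≡ adj G u v) where

  TwoSwitch-embed : ∀ {a b c d} → TwoSwitch G a b c d → TwoSwitch H (f a) (f b) (f c) (f d)
  TwoSwitch-embed {a} {b} {c} {d} (a≢b , a≢c , a≢d , b≢c , b≢d , c≢d , ab , cd , ¬ac , ¬bd) =
    a≢b ∘ f-injective , a≢c ∘ f-injective , a≢d ∘ f-injective ,
    b≢c ∘ f-injective , b≢d ∘ f-injective , c≢d ∘ f-injective ,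
    trans (f-induced a b) ab , trans (f-induced c d) cd ,
    ¬ac ∘ trans (sym (f-induced a c)) , ¬bd ∘ trans (sym (f-induced b d))

  Active-embed : ∀ {v} → Active G v → Active H (f v)
  Active-embed (a , b , c , d , switch , v∈abcd) =
    f a , f b , f c , f d , TwoSwitch-embed switch , map-cong v∈abcd
    where
    map-cong : ∀ {v a b c d} → v ≡ a ⊎ v ≡ b ⊎ v ≡ c ⊎ v ≡ d →
               f v ≡ f a ⊎ f v ≡ f b ⊎ f v ≡ f c ⊎ f v ≡ f d
    map-cong (inj₁ refl)                  = inj₁ refl
    map-cong (inj₂ (inj₁ refl))           = inj₂ (inj₁ refl)
    map-cong (inj₂ (inj₂ (inj₁ refl)))    = inj₂ (inj₂ (inj₁ refl))
    map-cong (inj₂ (inj₂ (inj₂ refl)))    = inj₂ (inj₂ (inj₂ refl))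

active? : (G : Graph n) (v : Fin n) → Dec (Active G v)
active? G v = any? λ a → any? λ b → any? λ c → any? λ d →
  (¬? (a ≟ᶠ b) ×-dec ¬? (a ≟ᶠ c) ×-dec ¬? (a ≟ᶠ d) ×-dec
   ¬? (b ≟ᶠ c) ×-dec ¬? (b ≟ᶠ d) ×-dec ¬? (c ≟ᶠ d) ×-dec
   (adj G a b ≟ true) ×-dec (adj G c d ≟ true) ×-dec
   ¬? (adj G a c ≟ true) ×-dec ¬? (adj G b d ≟ true))
  ×-dec ((v ≟ᶠ a) ⊎-dec (v ≟ᶠ b) ⊎-dec (v ≟ᶠ c) ⊎-dec (v ≟ᶠ d))

Twins : Graph n → Fin n → Fin n → Set
Twins G x a = ∀ u → u ≢ x → u ≢ a → adj G x u ≡ adj G a u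

module _ (G : Graph n) {x a : Fin n} (twins : Twins G x a) where

  private
    swap : Fin n → Fin n
    swap = transpose x a ⟨$⟩ʳ_

  adj-swap-other : ∀ u {w} → w ≢ x → w ≢ a → adj G (swap u) w ≡ adj G u w
  adj-swap-other u {w} w≢x w≢a with ≟-pair x a u
  ... | inj₁ refl rewrite transpose-matchˡ u a = sym (twins w w≢x w≢a)
  ... | inj₂ (inj₁ refl) rewrite transpose-matchʳ x u = twins w w≢x w≢a
  ... | inj₂ (inj₂ (u≢x , u≢a)) rewrite transpose-other x a u≢x u≢a = refl

  adj-swap-x : ∀ u → adj G (swap u) x ≡ adj G u a
  adj-swap-x u with ≟-pair x a u
  ... | inj₁ refl rewrite transpose-matchˡ u a = adj-sym G a u
  ... | inj₂ (inj₁ refl) rewrite transpose-matchʳ x u = trans (irrefl G x) (sym (irrefl G u))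
  ... | inj₂ (inj₂ (u≢x , u≢a)) rewrite transpose-other x a u≢x u≢a =
    trans (adj-sym G u x) (trans (twins u u≢x u≢a) (adj-sym G a u))

  adj-swap-a : ∀ u → adj G (swap u) a ≡ adj G u x
  adj-swap-a u with ≟-pair x a u
  ... | inj₁ refl rewrite transpose-matchˡ u a = trans (irrefl G a) (sym (irrefl G u))
  ... | inj₂ (inj₁ refl) rewrite transpose-matchʳ x u = adj-sym G x u
  ... | inj₂ (inj₂ (u≢x , u≢a)) rewrite transpose-other x a u≢x u≢a =
    trans (adj-sym G u a) (trans (sym (twins u u≢x u≢a)) (adj-sym G x u))

  adj-swap : ∀ u v → adj G (swap u) (swap v) ≡ adj G u v
  adj-swap u v with ≟-pair x a v
  ... | inj₁ refl rewrite transpose-matchˡ v a = adj-swap-a u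
  ... | inj₂ (inj₁ refl) rewrite transpose-matchʳ x v = adj-swap-x u
  ... | inj₂ (inj₂ (v≢x , v≢a)) rewrite transpose-other x a v≢x v≢a = adj-swap-other u v≢x v≢a

  Active-twin : Active G a → Active G x
  Active-twin act = subst (Active G) (transpose-matchʳ x a)
    (Active-embed {G = G} {H = G} (Injection.injective (↔⇒↣ (transpose x a))) adj-swap act)

module _ (G : Graph n) where

  -- Composing with the transposition (a x) matches a ∈ N(x) against x ∈ N(a), making
  -- N(x) ∖ {a} ⊆ N(a) a pointwise inclusion of indicator functions.
  deg-<-dominated : ∀ {x a} → (∀ u → u ≢ a → Edge G x u → Edge G a u) →
    ∀ w → w ≢ x → ¬ Edge G x w → Edge G a w → deg G x < deg G a
  deg-<-dominated {x} {a} N[x]⊆N[a] w w≢x ¬xw aw = begin-strict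
    deg G x                      ≡⟨ deg≡count G x ⟩
    count (adj G x)              ≡⟨ count-permute (adj G x) (transpose a x) ⟩
    count (adj G x ∘ swap)       <⟨ count-mono-< swap-⊆ w ¬x-swap-w aw ⟩
    count (adj G a)              ≡⟨ sym (deg≡count G a) ⟩
    deg G a                      ∎
    where
    open ≤-Reasoning
    swap : Fin n → Fin n
    swap = transpose a x ⟨$⟩ʳ_
    w≢a : w ≢ a
    w≢a refl = not-¬ (irrefl G w) aw
    ¬x-swap-w : ¬ Edge G x (swap w)
    ¬x-swap-w rewrite transpose-other a x w≢a w≢x = ¬xw
    swap-⊆ : ∀ u → Edge G x (swap u) → Edge G a u
    swap-⊆ u x-swap-u with ≟-pair a x u
    ... | inj₁ refl rewrite transpose-matchˡ u x = ⊥-elim (not-¬ (irrefl G x) x-swap-u)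
    ... | inj₂ (inj₁ refl) rewrite transpose-matchʳ a u = trans (adj-sym G a u) x-swap-u
    ... | inj₂ (inj₂ (u≢a , u≢x)) rewrite transpose-other a x u≢a u≢x = N[x]⊆N[a] u u≢a x-swap-u

  inactive-nested : ∀ {x a w z} → Inactive G x → a ≢ x → w ≢ a → z ≢ x →
    Edge G x w → ¬ Edge G a w → Edge G a z → ¬ Edge G x z → ⊥
  inactive-nested {x} {a} {w} {z} x-inactive a≢x w≢a z≢x xw ¬aw az ¬xz =
    x-inactive (w , x , a , z , switch , inj₂ (inj₁ refl))
    where
    w≢x : w ≢ x
    w≢x refl = not-¬ (irrefl G w) xw
    w≢z : w ≢ z
    w≢z refl = ¬xz xw
    a≢z : a ≢ z
    a≢z refl = not-¬ (irrefl G a) az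
    switch : TwoSwitch G w x a z
    switch = w≢x , w≢a , w≢z , a≢x ∘ sym , z≢x ∘ sym , a≢z ,
             trans (adj-sym G w x) xw , az , ¬aw ∘ trans (adj-sym G a w) , ¬xz

  inactive-equal-degree-twins : ∀ {x a} → Inactive G x → x ≢ a → deg G x ≡ deg G a → Twins G x a
  inactive-equal-degree-twins {x} {a} x-inactive x≢a deg≡ u u≢x u≢a
    with adj G x u in xu | adj G a u in au
  ... | true  | true  = refl
  ... | false | false = refl
  ... | true  | false =
    ⊥-elim (<-irrefl (sym deg≡) (deg-<-dominated a-dominated u u≢a (not-¬ au) xu))
    where
    a-dominated : ∀ z → z ≢ x → Edge G a z → Edge G x z
    a-dominated z z≢x az with adj G x z in xz
    ... | true  = refl
    ... | false = ⊥-elim (inactive-nested x-inactive (x≢a ∘ sym) u≢a z≢x xu (not-¬ au) az (not-¬ xz))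
  ... | false | true  =
    ⊥-elim (<-irrefl deg≡ (deg-<-dominated x-dominated u u≢x (not-¬ xu) au))
    where
    x-dominated : ∀ w → w ≢ a → Edge G x w → Edge G a w
    x-dominated w w≢a xw with adj G a w in aw
    ... | true  = refl
    ... | false = ⊥-elim (inactive-nested x-inactive (x≢a ∘ sym) w≢a u≢x xw (not-¬ aw) au (not-¬ xu))

  Active-equal-degree : ∀ {a x} → Active G a → deg G x ≡ deg G a → Active G x
  Active-equal-degree {a} {x} a-active deg≡ = decidable-stable (active? G x) λ x-inactive →
    let x≢a : x ≢ a
        x≢a x≡a = x-inactive (subst (Active G) (sym x≡a) a-active)
    in x-inactive (Active-twin G (inactive-equal-degree-twins x-inactive x≢a deg≡) a-active)

mainTheorem2 : ∀ {n} (G : Graph n) (a : Fin n) →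
    (Active G a → ∀ x → deg G x ≡ deg G a → Active G x) ×
    (Inactive G a → ∀ x → deg G x ≡ deg G a → Inactive G x)
mainTheorem2 G a =
  (λ a-active _ deg≡ → Active-equal-degree G a-active deg≡) ,
  (λ a-inactive _ deg≡ x-active → a-inactive (Active-equal-degree G x-active (sym deg≡)))
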